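{- Let $\succ$ be a complete strict social rule on $X$ with irreducible components $\mathcal T_1,\dots,\mathcal T_r$ and maximal component $\mathcal T_{\max}=\mathcal T_r$, and let $z\in X$. Suppose there is an irreducible component $\mathcal T_i\ne\mathcal T_{\max}$ such that $G^z_x\subseteq\mathcal T_i$ for every $x\in\mathcal T_i$. Then $z$ is not a u-local optimum.
   Context: Fix $n\ge1$ and positive integers $m_1,\dots,m_n$; social outcomes are $n$-tuples $x$ with $0\le x_i<m_i$, forming $X$. A complete strict social rule $\succ$ on $X$: for distinct $x,y$ exactly one of $x\succ y$, $y\succ x$ (not necessarily transitive); view it as a tournament with an arc $x\to y$ when $x\succ y$. The irreducible components are the maximal sub-tournaments in which every two nodes lie on a common directed cycle; they partition $X$ and are indexed $\mathcal T_1,\dots,\mathcal T_r$ so that for $i>j$ every node of $\mathcal T_i$ dominates every node of $\mathcal T_j$. For $x,y\in X$, $\overline H_{x,y}=\{k:x_k\ne y_k\}$, $d_p(x,y)=|\overline H_{x,y}|$. An object is a nonempty $I\subseteq\{1,\dots,n\}$; an objects scheme is a finite set $A$ of objects with union $\{1,\dots,n\}$. $\Phi(x,I)=\{y: y\succ x,\ y_k=x_k\ \forall k\notin I\}$; $B(x,I)$ is the set of $y\in\Phi(x,I)$ with $y\succ w$ for all $w\in\Phi(x,I)\setminus\{y\}$. $x$ is a local optimum for $A$ if $\Phi(x,I)=\emptyset$ for all $I\in A$. A domination path through $A$ from $x$ to $y$ is a sequence $x=x_0,\dots,x_s=y$ ($s\ge0$) with, for each $i\ge1$, some $I\in A$ with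 $x_i\in B(x_{i-1},I)$. $\Psi(z,A)$ is the set of $x$ such that $z$ is a local optimum for $A$ and a domination path through $A$ from $x$ to $z$ exists; $\Psi(z)=\bigcup_A\Psi(z,A)$; $z$ is a u-local optimum if $\Psi(z)=X$. $z$ is free if $d_p(w,z)>1$ for all $w\succ z$. If $z$ is free, $G^z_x=\{y\in X: y\succ x,\ \overline H_{w,z}\not\subseteq\overline H_{x,y}\ \forall w\succ z,\ B(x,\overline H_{x,y})\ne\emptyset\}$; if $z$ is not free, $G^z_x=\emptyset$. -}

module Defs where

open import Data.Nat using (ℕ; zero; suc; _<_; _>_)
open import Data.Bool using (Bool; true; false; not)
open import Data.Fin using (Fin; zero; suc)
open import Data.Fin.Properties using () renaming (_≟_ to _≟ᶠ_)
open import Data.Fin.Subset using (Subset; _∈_; _∉_; _⊆_; Nonempty)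
open import Data.Vec using (Vec; []; _∷_; lookup; tabulate)
open import Data.List using (List; length; filter; allFin)
open import Data.List.Membership.Propositional using () renaming (_∈_ to _∈ˡ_)
open import Data.List.Base using (List)
open import Data.Product using (Σ; ∃; _×_; _,_)
open import Data.Sum using (_⊎_)
open import Relation.Nullary using (¬_; Dec; ¬?)
open import Relation.Nullary.Decidable using (⌊_⌋)
open import Relation.Binary.PropositionalEquality using (_≡_; _≢_)
open import Relation.Binary.Construct.Closure.ReflexiveTransitive using (Star)
open import Data.Fin.Base using () renaming (_≤_ to _≤ᶠ_)

-- Social outcomes: n-tuples x with 0 ≤ x_k < m_k, encoded as an inductive
-- product of Fin's so that equality of outcomes is first-order.
data Pt : {n : ℕ} → Vec ℕ n → Set where
  []  : Pt []
  _∷_ : {n : ℕ} {k : ℕ} {ms : Vec ℕ n} → Fin k → Pt ms → Pt (k ∷ ms)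

coord : {n : ℕ} {ms : Vec ℕ n} → Pt ms → (k : Fin n) → Fin (lookup ms k)
coord (a ∷ x) zero    = a
coord (a ∷ x) (suc k) = coord x k

module Rule {n : ℕ} (m : Vec ℕ n) (R : Pt m → Pt m → Bool) where

  X : Set
  X = Pt m

  _≻_ : X → X → Set
  x ≻ y = R x y ≡ true

  IsCompleteStrict : Set
  IsCompleteStrict =
    (∀ x y → x ≻ y → ¬ (y ≻ x)) × (∀ x y → x ≢ y → (x ≻ y) ⊎ (y ≻ x))

  Reach : X → X → Set
  Reach = Star _≻_

  SameComp : X → X → Set
  SameComp x y = Reach x y × Reach y x

  -- the irreducible component containing a is the maximal one T_max:
  -- each of its nodes dominates every node of every other component
  IsMaxComponentOf : X → Set
  IsMaxComponentOf a = ∀ x y → SameComp a x → ¬ SameComp a y → x ≻ y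

  Hbar : X → X → Subset n
  Hbar x y = tabulate (λ k → not ⌊ coord x k ≟ᶠ coord y k ⌋)

  dp : X → X → ℕ
  dp x y = length (filter (λ k → ¬? (coord x k ≟ᶠ coord y k)) (allFin n))

  Φ : X → Subset n → X → Set
  Φ x I y = (y ≻ x) × (∀ k → k ∉ I → coord y k ≡ coord x k)

  B : X → Subset n → X → Set
  B x I y = Φ x I y × (∀ w → Φ x I w → w ≢ y → y ≻ w)

  IsScheme : List (Subset n) → Set
  IsScheme A = (∀ I → I ∈ˡ A → Nonempty I) × (∀ k → ∃ λ I → I ∈ˡ A × k ∈ I)

  LocalOpt : List (Subset n) → X → Set
  LocalOpt A x = ∀ I → I ∈ˡ A → ∀ y → ¬ Φ x I y

  data DomPath (A : List (Subset n)) : X → X → Set where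
    done : ∀ {x} → DomPath A x x
    step : ∀ {x x₁ y} I → I ∈ˡ A → B x I x₁ → DomPath A x₁ y → DomPath A x y

  ΨA : X → List (Subset n) → X → Set
  ΨA z A x = LocalOpt A z × DomPath A x z

  Ψ : X → X → Set
  Ψ z x = ∃ λ A → IsScheme A × ΨA z A x

  ULocalOpt : X → Set
  ULocalOpt z = ∀ x → Ψ z x

  Free : X → Set
  Free z = ∀ w → w ≻ z → dp w z > 1

  -- G^z_x (empty when z is not free)
  G : X → X → X → Set
  G z x y = Free z × (y ≻ x)
          × (∀ w → w ≻ z → ¬ (Hbar w z ⊆ Hbar x y))
          × (∃ λ v → B x (Hbar x y) v)

{-# OPTIONS --safe #-}
-- If z were a u-local optimum, some objects scheme A would witness a ∈ Ψ(z,A).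
-- Local optimality of z for A forces z to be free (a dominator at distance one
-- would lie in Φ(z,I) for an object I containing the coordinate it changes),
-- and then every step x → y of a domination path through A satisfies y ∈ G^z_x.
-- So the path from a to z never leaves the component of a, i.e. a reaches z.
-- But every y has a domination path to z, along which z reaches y; thus the
-- component of a reaches every node, which makes it the maximal component.
module Submission where

open import Defs
open import Data.Nat using (ℕ; _≤_; suc; s≤s)
open import Data.Nat.Properties using (_≤?_; ≰⇒>)
open import Data.Bool using (Bool; true; not)
open import Data.Fin using (Fin; zero; suc)
open import Data.Fin.Properties using (¬∀⟶∃¬) renaming (_≟_ to _≟ᶠ_)
open import Data.Fin.Subset using (Subset; _∈_; _∉_; _⊆_)
open import Data.Fin.Subset.Properties using (_∈?_)
open import Data.Vec using (Vec; lookup)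
open import Data.Vec.Properties using ([]=⇒lookup; lookup⇒[]=; lookup∘tabulate)
open import Data.List using (List; length; filter)
import Data.List as List
open import Data.List.Membership.Propositional using () renaming (_∈_ to _∈ˡ_)
open import Data.Product using (∃; _×_; _,_; proj₁)
open import Data.Sum using (inj₁; inj₂)
open import Function using (_∘_)
open import Relation.Nullary using (¬_; Dec; yes; no; ⌊_⌋; ¬?; contradiction)
open import Relation.Nullary.Decidable using (decidable-stable)
open import Relation.Unary using (Pred; Decidable)
open import Relation.Binary.PropositionalEquality using (_≡_; _≢_; refl; sym; trans; cong; cong₂)
open import Relation.Binary.Construct.Closure.ReflexiveTransitive using (ε; _◅_; _◅◅_)

module _ {a p} {A : Set a} {P : Pred A p} (P? : Decidable P) where

  filter-tabulate-empty : ∀ {n} (f : Fin n → A) →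
    length (filter P? (List.tabulate f)) ≤ 0 → ∀ i → ¬ P (f i)
  filter-tabulate-empty {suc n} f le i pᵢ with P? (f zero)
  filter-tabulate-empty {suc n} f () i pᵢ | yes _
  filter-tabulate-empty {suc n} f le zero pᵢ | no ¬p₀ = ¬p₀ pᵢ
  filter-tabulate-empty {suc n} f le (suc i) pᵢ | no _ = filter-tabulate-empty (f ∘ suc) le i pᵢ

  filter-tabulate-atMostOne : ∀ {n} (f : Fin n → A) →
    length (filter P? (List.tabulate f)) ≤ 1 → ∀ {i j} → P (f i) → P (f j) → i ≡ j
  filter-tabulate-atMostOne {suc n} f le {i} {j} pᵢ pⱼ with P? (f zero) | le
  ... | yes _ | s≤s le′ = only-zero i pᵢ j pⱼ
    where
    only-zero : ∀ i → P (f i) → ∀ j → P (f j) → i ≡ j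
    only-zero zero    _  zero    _  = refl
    only-zero (suc i) pᵢ _       _  = contradiction pᵢ (filter-tabulate-empty (f ∘ suc) le′ i)
    only-zero zero    _  (suc j) pⱼ = contradiction pⱼ (filter-tabulate-empty (f ∘ suc) le′ j)
  ... | no ¬p₀ | le′ with i | j
  ...   | zero  | _     = contradiction pᵢ ¬p₀
  ...   | _     | zero  = contradiction pⱼ ¬p₀
  ...   | suc _  | suc _  = cong suc (filter-tabulate-atMostOne (f ∘ suc) le′ pᵢ pⱼ)

isNo≡true⁺ : ∀ {p} {P : Set p} (d : Dec P) → ¬ P → not ⌊ d ⌋ ≡ true
isNo≡true⁺ (yes x) ¬x = contradiction x ¬x
isNo≡true⁺ (no _)  _  = refl

isNo≡true⁻ : ∀ {p} {P : Set p} (d : Dec P) → not ⌊ d ⌋ ≡ true → ¬ P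
isNo≡true⁻ (no ¬x) _ = ¬x

coord-injective : ∀ {n} {ms : Vec ℕ n} (w z : Pt ms) → (∀ j → coord w j ≡ coord z j) → w ≡ z
coord-injective [] [] _ = refl
coord-injective (a ∷ w) (b ∷ z) eq = cong₂ _∷_ (eq zero) (coord-injective w z (eq ∘ suc))

≢⇒∃-coord≢ : ∀ {n} {ms : Vec ℕ n} (w z : Pt ms) → w ≢ z → ∃ λ k → coord w k ≢ coord z k
≢⇒∃-coord≢ {n} w z w≢z =
  ¬∀⟶∃¬ n _ (λ k → coord w k ≟ᶠ coord z k) (w≢z ∘ coord-injective w z)

module _ {n : ℕ} (m : Vec ℕ n) (R : Pt m → Pt m → Bool) where
  open Rule m R

  ∈-Hbar⁺ : ∀ u v {j} → coord u j ≢ coord v j → j ∈ Hbar u v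
  ∈-Hbar⁺ u v {j} ne =
    lookup⇒[]= j _ (trans (lookup∘tabulate _ j) (isNo≡true⁺ (coord u j ≟ᶠ coord v j) ne))

  ∈-Hbar⁻ : ∀ u v {j} → j ∈ Hbar u v → coord u j ≢ coord v j
  ∈-Hbar⁻ u v {j} j∈ =
    isNo≡true⁻ (coord u j ≟ᶠ coord v j) (trans (sym (lookup∘tabulate _ j)) ([]=⇒lookup j∈))

  ∉-Hbar⁻ : ∀ u v {j} → j ∉ Hbar u v → coord u j ≡ coord v j
  ∉-Hbar⁻ u v {j} j∉ = decidable-stable (coord u j ≟ᶠ coord v j) (j∉ ∘ ∈-Hbar⁺ u v)

  dp≤1⇒coord≡-off : ∀ w z {k} → dp w z ≤ 1 → coord w k ≢ coord z k →
    ∀ j → j ≢ k → coord w j ≡ coord z j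
  dp≤1⇒coord≡-off w z {k} le wₖ≢zₖ j j≢k =
    decidable-stable (coord w j ≟ᶠ coord z j) λ wⱼ≢zⱼ →
      j≢k (filter-tabulate-atMostOne (λ i → ¬? (coord w i ≟ᶠ coord z i)) (λ i → i) le wⱼ≢zⱼ wₖ≢zₖ)

  DomPath⇒Reach-converse : ∀ {A x y} → DomPath A x y → Reach y x
  DomPath⇒Reach-converse done = ε
  DomPath⇒Reach-converse (step _ _ ((x₁≻x , _) , _) rest) = DomPath⇒Reach-converse rest ◅◅ (x₁≻x ◅ ε)

  reachesAll⇒IsMaxComponentOf : IsCompleteStrict → ∀ a → (∀ y → Reach a y) → IsMaxComponentOf a
  reachesAll⇒IsMaxComponentOf (_ , total) a reach x y (a↝x , x↝a) a≁y
    with total x y (λ { refl → a≁y (a↝x , x↝a) })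
  ... | inj₁ x≻y = x≻y
  ... | inj₂ y≻x = contradiction (reach y , y≻x ◅ x↝a) a≁y

  module _ (asym : ∀ x y → x ≻ y → ¬ (y ≻ x)) {z : X} {A : List (Subset n)}
           (cover : ∀ k → ∃ λ I → I ∈ˡ A × k ∈ I) (zOpt : LocalOpt A z) where

    localOpt⇒Free : Free z
    localOpt⇒Free w w≻z with dp w z ≤? 1
    ... | no ≰ = ≰⇒> ≰
    ... | yes le with ≢⇒∃-coord≢ w z (λ { refl → asym w w w≻z w≻z })
    ... | k , wₖ≢zₖ with cover k
    ... | I , I∈A , k∈I = contradiction (w≻z , λ j j∉I →
            dp≤1⇒coord≡-off w z le wₖ≢zₖ j λ { refl → j∉I k∈I }) (zOpt I I∈A w)

    B⇒G : ∀ {x y I} → I ∈ˡ A → B x I y → G z x y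
    B⇒G {x} {y} {I} I∈A ((y≻x , y≡x-off-I) , y-best) =
      localOpt⇒Free , y≻x , Hbar-not-covered , y , (y≻x , y≡x-off-Hbar) , y-best-on-Hbar
      where
      y≡x-off-Hbar : ∀ j → j ∉ Hbar x y → coord y j ≡ coord x j
      y≡x-off-Hbar j j∉ = sym (∉-Hbar⁻ x y j∉)

      Hbar⊆I : ∀ {j} → j ∈ Hbar x y → j ∈ I
      Hbar⊆I {j} j∈ = decidable-stable (j ∈? I) λ j∉I →
        ∈-Hbar⁻ x y j∈ (sym (y≡x-off-I j j∉I))

      Hbar-not-covered : ∀ w → w ≻ z → ¬ (Hbar w z ⊆ Hbar x y)
      Hbar-not-covered w w≻z sub = zOpt I I∈A w (w≻z , λ j j∉I →
        ∉-Hbar⁻ w z (j∉I ∘ Hbar⊆I ∘ sub))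

      y-best-on-Hbar : ∀ v → Φ x (Hbar x y) v → v ≢ y → y ≻ v
      y-best-on-Hbar v (v≻x , v≡x-off-Hbar) =
        y-best v (v≻x , λ j j∉I → v≡x-off-Hbar j (j∉I ∘ Hbar⊆I))

    DomPath-preserves-G-closed : ∀ {ℓ} (S : Pred X ℓ) → (∀ x → S x → ∀ y → G z x y → S y) →
      ∀ {x y} → S x → DomPath A x y → S y
    DomPath-preserves-G-closed S closed Sx done = Sx
    DomPath-preserves-G-closed S closed Sx (step _ I∈A b rest) =
      DomPath-preserves-G-closed S closed (closed _ Sx _ (B⇒G I∈A b)) rest

mainTheorem9 : {n : ℕ} (m : Vec ℕ n) → (∀ k → 1 ≤ lookup m k) →
    (R : Pt m → Pt m → Bool) →
    let open Rule m R in
    IsCompleteStrict → (z : Pt m) →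
    (∃ λ a → ¬ IsMaxComponentOf a
    × (∀ x → SameComp a x → ∀ y → G z x y → SameComp a y)) →
    ¬ ULocalOpt z
mainTheorem9 m _ R strict@(asym , _) z (a , notMax , closed) uOpt =
  notMax (reachesAll⇒IsMaxComponentOf m R strict a λ y → proj₁ a∼z ◅◅ z↝ y)
  where
  open Rule m R

  a∼z : SameComp a z
  a∼z with uOpt a
  ... | _ , (_ , cover) , zOpt , path =
    DomPath-preserves-G-closed m R asym cover zOpt (SameComp a) closed (ε , ε) path

  z↝ : ∀ y → Reach z y
  z↝ y with uOpt y
  ... | _ , _ , _ , path = DomPath⇒Reach-converse m R path
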